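{- For all words $v,w$ and integers $m\ge\max(v)$, $n\ge\max(w)$, the convolution product in $\mathrm{End}(\mathsf{Shuffle})$ satisfies $$[v,m]*[w,n] = \sum_{u\in\operatorname{sh}(v,\,w\uparrow m)}[u,m+n],$$ where the sum is over the shuffle multiset (with multiplicity). Consequently the span $\mathbf{W}$ of all the maps $[w,n]$ is a subalgebra of the convolution algebra $\mathrm{End}(\mathsf{Shuffle})$.
   Context: Fix a field $\mathbb{k}$. A word is a finite sequence of positive integers; $\max(w)$ is its largest letter ($\max(\emptyset)=0$) and $\ell(w)$ its length. $\mathsf{Shuffle}$ is the $\mathbb{k}$-vector space with basis all words, with product $\operatorname{sh}$ given on words $u$ (length $a$), $v$ (length $b$) by $\operatorname{sh}(u,v)=\sum_{I\subseteq\{1,\dots,a+b\},|I|=a} x_I$, where $x_I$ is the word with $x_I|_I=u$ and $x_I|_{I^c}=v$ (here $x|_I$ is the subword at positions $I$), and coproduct $\Delta(w_1\cdots w_k)=\sum_{i=0}^k w_1\cdots w_i\otimes w_{i+1}\cdots w_k$. The convolution product on linear maps $f,g:\mathsf{Shuffle}\to\mathsf{Shuffle}$ is $f*g=\operatorname{sh}\circ(f\otimes g)\circ\Delta$. For a word $w=w_1\cdots w_k$ with $\max(w)\le n$, $[w,n]\in\mathrm{End}(\mathsf{Shuffle})$ is the linear map sending a word $v=v_1\cdots v_n$ of length exactly $n$ to $v_{w_1}v_{w_2}\cdots v_{w_k}$ and every other word to $0$ ($[\emptyset,n]$ sends length-$n$ words to $\emptyset$). For a word $w$, $w\uparrow m$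 is obtained by adding $m$ to each letter. -}

module Defs where

open import Level using (Level; _⊔_; suc)
open import Algebra.Bundles using (CommutativeRing)
open import Data.Nat as ℕ using (ℕ; zero; _≤_; _≟_)
open import Data.Bool using (Bool; true; false; if_then_else_)
open import Data.List as List using (List; []; _∷_; _++_; length; map; take; drop; concatMap; filter; foldr)
open import Data.List.Properties using (≡-dec)
open import Data.List.Relation.Unary.All using (All)
open import Data.Product using (Σ; _×_; _,_; ∃)
open import Relation.Nullary using (¬_; Dec; yes; no)
open import Relation.Nullary.Decidable using (⌊_⌋)
open import Relation.Binary.PropositionalEquality using (_≡_)

record Field (c ℓ : Level) : Set (Level.suc (c Level.⊔ ℓ)) where
  field
    commutativeRing : CommutativeRing c ℓ
  open CommutativeRing commutativeRing public
  field
    1≉0     : ¬ (1# ≈ 0#)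
    inverse : ∀ x → ¬ (x ≈ 0#) → Σ Carrier (λ y → x * y ≈ 1#)

Word : Set
Word = List ℕ

-- the predicate "all letters are positive" (a genuine basis word)
IsWord : Word → Set
IsWord = All (λ a → 1 ≤ a)

maxW : Word → ℕ
maxW = foldr ℕ._⊔_ 0

_↑_ : Word → ℕ → Word
w ↑ m = map (λ a → a ℕ.+ m) w

_≟W_ : (u v : Word) → Dec (u ≡ v)
_≟W_ = ≡-dec _≟_

-- Shuffle product of words, following the definition via index sets:
-- an index set I ⊆ {1,…,a+b} is encoded by its characteristic list
-- (a Bool list of length a+b); |I| = a means exactly a entries are true.
-- x_I is the word with x_I|_I = u and x_I|_{I^c} = v.

boolLists : ℕ → List (List Bool)
boolLists zero    = [] ∷ []
boolLists (ℕ.suc n) = map (true ∷_) (boolLists n) ++ map (false ∷_) (boolLists n)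

countTrue : List Bool → ℕ
countTrue []          = 0
countTrue (true ∷ I)  = ℕ.suc (countTrue I)
countTrue (false ∷ I) = countTrue I

xI : List Bool → Word → Word → Word
xI []          u       v       = []
xI (true ∷ I)  (a ∷ u) v       = a ∷ xI I u v
xI (true ∷ I)  []      v       = []          -- never happens for |I| = ℓ(u)
xI (false ∷ I) u       (b ∷ v) = b ∷ xI I u v
xI (false ∷ I) u       []      = []          -- never happens for |I^c| = ℓ(v)

subsets : ℕ → ℕ → List (List Bool)
subsets a b = filter (λ I → countTrue I ≟ a) (boolLists (a ℕ.+ b))

shW : Word → Word → List Word
shW u v = map (λ I → xI I u v) (subsets (length u) (length v))

module Shuffle {c ℓ} (k : Field c ℓ) where
  open Field k

  -- an element of Shuffle: a finite formal linear combination of words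
  Vect : Set c
  Vect = List (Carrier × Word)

  coeff : Vect → Word → Carrier
  coeff []            u = 0#
  coeff ((a , x) ∷ f) u with x ≟W u
  ... | yes _ = a + coeff f u
  ... | no  _ = coeff f u

  _≈V_ : Vect → Vect → Set ℓ
  f ≈V g = ∀ u → coeff f u ≈ coeff g u

  zeroV : Vect
  zeroV = []

  _+V_ : Vect → Vect → Vect
  _+V_ = _++_

  _·V_ : Carrier → Vect → Vect
  a ·V f = map (λ { (b , x) → (a * b , x) }) f

  basis : Word → Vect
  basis x = (1# , x) ∷ []

  sumV : List Vect → Vect
  sumV = foldr _+V_ zeroV

  sh : Vect → Vect → Vect
  sh f g = concatMap (λ { (a , x) → concatMap (λ { (b , y) →
             map (λ z → (a * b , z)) (shW x y) }) g }) f

  -- a linear endomorphism of Shuffle, given by its values on basis words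
  End : Set c
  End = Word → Vect

  _≈E_ : End → End → Set ℓ
  F ≈E G = ∀ x → IsWord x → F x ≈V G x

  _+E_ : End → End → End
  (F +E G) x = F x +V G x

  _·E_ : Carrier → End → End
  (a ·E F) x = a ·V F x

  zeroE : End
  zeroE x = zeroV

  sumE : List End → End
  sumE = foldr _+E_ zeroE

  -- Δ(w₁⋯w_k) = Σ_{i=0}^{k} w₁⋯w_i ⊗ w_{i+1}⋯w_k
  splits : Word → List (Word × Word)
  splits w = map (λ i → (take i w , drop i w)) (List.upTo (ℕ.suc (length w)))

  -- convolution product  F * G = sh ∘ (F ⊗ G) ∘ Δ
  _⋆_ : End → End → End
  (F ⋆ G) w = sumV (map (λ { (x , y) → sh (F x) (G y) }) (splits w))

  -- unit of the convolution algebra: η ∘ ε  (∅ ↦ ∅, other words ↦ 0)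
  unitE : End
  unitE []      = basis []
  unitE (_ ∷ _) = zeroV

  -- 1-indexed letter of a word (default 0 out of range; never used
  -- out of range when max(w) ≤ n)
  letter : Word → ℕ → ℕ
  letter []      _               = 0
  letter (a ∷ v) zero            = 0
  letter (a ∷ v) (ℕ.suc zero)    = a
  letter (a ∷ v) (ℕ.suc (ℕ.suc i)) = letter v (ℕ.suc i)

  -- [w,n] : v₁⋯v_n ↦ v_{w₁}⋯v_{w_k}, other words ↦ 0
  bracket : Word → ℕ → End
  bracket w n v with length v ≟ n
  ... | yes _ = basis (map (letter v) w)
  ... | no  _ = zeroV

  InW : End → Set (c Level.⊔ ℓ)
  InW F = ∃ λ (L : List (Carrier × Word × ℕ)) →
            All (λ { (_ , w , n) → IsWord w × maxW w ≤ n }) L ×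
            (F ≈E sumE (map (λ { (a , w , n) → a ·E bracket w n }) L))

{-# OPTIONS --safe #-}
-- If ℓ(x) = m + n, the only term y ⊗ z of Δ(x) on which both [v,m] and [w,n] are nonzero is
-- y = take m x, z = drop m x, and it contributes sh(v(y), w(z)), where v(y) reads the letters of y
-- along v; for any other length every term vanishes.  Relabelling letters commutes with shuffling, so
-- sh(v(y), w(z)) is the image of sh(v, w ↑ m) under reading letters of x, that is Σ_u [u, m+n](x).
-- W is closed under ⋆ because the coefficients of (F ⋆ G)(x) are bilinear in the coefficients of the
-- values of F and G.
module Submission where

open import Defs
open import Data.Nat using (ℕ; _≤_; _+_; zero; suc; _<_; _∸_; _≟_; z≤n; s≤s; z<s; s<s)
open import Data.Nat.Properties
  using (≤-refl; ≤-trans; ≤-reflexive; ≤-pred; ⊔-lub; m⊔n≤o⇒m≤o; m⊔n≤o⇒n≤o; m≤m+n; +-comm; +-monoˡ-≤;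
         +-mono-≤; n≤1+n; suc-injective; m≤n⇒m⊓n≡m; m+n∸m≡n)
import Data.Nat.Properties as ℕ
open import Data.Bool using (true; false)
open import Data.List using (List; []; _∷_; _++_; map; length; take; drop; concat; concatMap; applyUpTo; upTo)
open import Data.List.Properties
  using (map-∘; map-cong; map-cong-local; length-map; length-take; length-drop; length-++; take++drop≡id;
         foldr-preservesᵇ; foldr-forcesᵇ)
open import Data.List.Relation.Unary.All as All using (All; []; _∷_)
open import Data.List.Relation.Unary.All.Properties using (map⁺; concat⁺; take⁺; drop⁺; applyUpTo⁺₁)
open import Data.Product using (_×_; _,_)
open import Data.Empty using (⊥-elim)
open import Function using (_∘_; id)
open import Relation.Nullary using (¬_; yes; no)
import Relation.Binary.PropositionalEquality as ≡
open ≡ using (_≡_; _≢_; cong; cong₂)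

maxW≤⇒All≤ : ∀ {K} w → maxW w ≤ K → All (_≤ K) w
maxW≤⇒All≤ = foldr-forcesᵇ (λ a b a⊔b≤K → m⊔n≤o⇒m≤o a b a⊔b≤K , m⊔n≤o⇒n≤o a b a⊔b≤K) 0

All≤⇒maxW≤ : ∀ {K w} → All (_≤ K) w → maxW w ≤ K
All≤⇒maxW≤ = foldr-preservesᵇ ⊔-lub z≤n

xI-All : ∀ {P : ℕ → Set} {u v} → All P u → All P v → ∀ I → All P (xI I u v)
xI-All pu       pv       []          = []
xI-All (p ∷ pu) pv       (true ∷ I)  = p ∷ xI-All pu pv I
xI-All []       pv       (true ∷ I)  = []
xI-All pu       (p ∷ pv) (false ∷ I) = p ∷ xI-All pu pv I
xI-All pu       []       (false ∷ I) = []

shW-All : ∀ {P : ℕ → Set} {u v} → All P u → All P v → All (All P) (shW u v)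
shW-All pu pv = map⁺ (All.universal (xI-All pu pv) _)

map-xI : ∀ (h : ℕ → ℕ) I u v → map h (xI I u v) ≡ xI I (map h u) (map h v)
map-xI h []          u       v       = ≡.refl
map-xI h (true ∷ I)  (a ∷ u) v       = cong (h a ∷_) (map-xI h I u v)
map-xI h (true ∷ I)  []      v       = ≡.refl
map-xI h (false ∷ I) u       (b ∷ v) = cong (h b ∷_) (map-xI h I u v)
map-xI h (false ∷ I) u       []      = ≡.refl

map-shW : ∀ (h : ℕ → ℕ) u v → map (map h) (shW u v) ≡ shW (map h u) (map h v)
map-shW h u v = begin
  map (map h) (map (λ I → xI I u v) S)   ≡⟨ map-∘ S ⟨
  map (λ I → map h (xI I u v)) S         ≡⟨ map-cong (λ I → map-xI h I u v) S ⟩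
  map (λ I → xI I (map h u) (map h v)) S ≡⟨ cong₂ (λ a b → map (λ I → xI I (map h u) (map h v)) (subsets a b))
                                                  (length-map h u) (length-map h v) ⟨
  shW (map h u) (map h v)                ∎
  where
  open ≡.≡-Reasoning
  S = subsets (length u) (length v)

length-take-≤ : ∀ {A : Set} (x : List A) {i} → i ≤ length x → length (take i x) ≡ i
length-take-≤ x {i} i≤x = ≡.trans (length-take i x) (m≤n⇒m⊓n≡m i≤x)

length-take+length-drop : ∀ {A : Set} i (x : List A) → length (take i x) + length (drop i x) ≡ length x
length-take+length-drop i x = ≡.trans (≡.sym (length-++ (take i x))) (cong length (take++drop≡id i x))

shW-admissible : ∀ {v w m n} → IsWord v → IsWord w → maxW v ≤ m → maxW w ≤ n →
                 All (λ s → IsWord s × maxW s ≤ m + n) (shW v (w ↑ m))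
shW-admissible {v} {w} {m} {n} v-word w-word v≤m w≤n =
  All.map (λ letters → let pos , bnd = All.unzip letters in pos , All≤⇒maxW≤ bnd)
          (shW-All (All.zip (v-word , All.map (λ a≤m → ≤-trans a≤m (m≤m+n m n)) (maxW≤⇒All≤ v v≤m)))
                   (map⁺ (All.zipWith shifted (w-word , maxW≤⇒All≤ w w≤n))))
  where
  shifted : ∀ {b} → 1 ≤ b × b ≤ n → 1 ≤ b + m × b + m ≤ m + n
  shifted {b} (1≤b , b≤n) = ≤-trans 1≤b (m≤m+n b m) , ≤-trans (+-monoˡ-≤ m b≤n) (≤-reflexive (+-comm n m))

module _ {c ℓ} (k : Field c ℓ) where
  open Field k renaming (_+_ to _+ₖ_; _*_ to _*ₖ_)
  open Shuffle k
  open import Algebra.Properties.CommutativeSemigroup +-commutativeSemigroup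
    using () renaming (interchange to +-interchange; x∙yz≈y∙xz to +-exchange)
  open import Algebra.Properties.CommutativeSemigroup *-commutativeSemigroup
    using () renaming (x∙yz≈y∙xz to *-exchange)
  open import Relation.Binary.Reasoning.Setoid setoid

  ∑ : ∀ {a} {A : Set a} → List A → (A → Carrier) → Carrier
  ∑ []      g = 0#
  ∑ (p ∷ l) g = g p +ₖ ∑ l g

  module _ {a} {A : Set a} where

    ∑-cong-All : ∀ {l : List A} {g h} → All (λ p → g p ≈ h p) l → ∑ l g ≈ ∑ l h
    ∑-cong-All []       = refl
    ∑-cong-All (e ∷ es) = +-cong e (∑-cong-All es)

    ∑-cong : ∀ (l : List A) {g h} → (∀ p → g p ≈ h p) → ∑ l g ≈ ∑ l h
    ∑-cong l e = ∑-cong-All (All.universal e l)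

    ∑-zero : ∀ {l : List A} {g} → All (λ p → g p ≈ 0#) l → ∑ l g ≈ 0#
    ∑-zero []       = refl
    ∑-zero (e ∷ es) = trans (+-cong e (∑-zero es)) (+-identityˡ 0#)

    ∑-++ : ∀ (l l′ : List A) g → ∑ (l ++ l′) g ≈ ∑ l g +ₖ ∑ l′ g
    ∑-++ []      l′ g = sym (+-identityˡ _)
    ∑-++ (p ∷ l) l′ g = trans (+-congˡ (∑-++ l l′ g)) (sym (+-assoc _ _ _))

    ∑-+ : ∀ (l : List A) g h → ∑ l (λ p → g p +ₖ h p) ≈ ∑ l g +ₖ ∑ l h
    ∑-+ []      g h = sym (+-identityˡ 0#)
    ∑-+ (p ∷ l) g h = trans (+-congˡ (∑-+ l g h)) (+-interchange _ _ _ _)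

    ∑-*ˡ : ∀ (l : List A) b g → ∑ l (λ p → b *ₖ g p) ≈ b *ₖ ∑ l g
    ∑-*ˡ []      b g = sym (zeroʳ b)
    ∑-*ˡ (p ∷ l) b g = trans (+-congˡ (∑-*ˡ l b g)) (sym (distribˡ b _ _))

    ∑-map : ∀ {b} {B : Set b} (f : B → A) l g → ∑ (map f l) g ≈ ∑ l (g ∘ f)
    ∑-map f []      g = refl
    ∑-map f (p ∷ l) g = +-congˡ (∑-map f l g)

    ∑-concatMap : ∀ {b} {B : Set b} (h : B → List A) l g → ∑ (concatMap h l) g ≈ ∑ l (λ p → ∑ (h p) g)
    ∑-concatMap h []      g = refl
    ∑-concatMap h (p ∷ l) g = trans (∑-++ (h p) (concatMap h l) g) (+-congˡ (∑-concatMap h l g))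

    ∑-applyUpTo-single : ∀ (f : ℕ → A) K {m g} → m < K → (∀ {i} → i < K → i ≢ m → g (f i) ≈ 0#) →
                         ∑ (applyUpTo f K) g ≈ g (f m)
    ∑-applyUpTo-single f (suc K) {zero} _ vanish =
      trans (+-congˡ (∑-zero (applyUpTo⁺₁ (f ∘ suc) K (λ i<K → vanish (s<s i<K) (λ ())))))
            (+-identityʳ _)
    ∑-applyUpTo-single f (suc K) {suc m} (s<s m<K) vanish =
      trans (+-cong (vanish z<s (λ ()))
                    (∑-applyUpTo-single (f ∘ suc) K m<K (λ i<K i≢m → vanish (s<s i<K) (i≢m ∘ suc-injective))))
            (+-identityˡ _)

  coeff-++ : ∀ f g u → coeff (f ++ g) u ≈ coeff f u +ₖ coeff g u
  coeff-++ []            g u = sym (+-identityˡ _)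
  coeff-++ ((a , x) ∷ f) g u with x ≟W u
  ... | yes _ = trans (+-congˡ (coeff-++ f g u)) (sym (+-assoc _ _ _))
  ... | no  _ = coeff-++ f g u

  coeff-· : ∀ a f u → coeff (a ·V f) u ≈ a *ₖ coeff f u
  coeff-· a []            u = sym (zeroʳ a)
  coeff-· a ((b , x) ∷ f) u with x ≟W u
  ... | yes _ = trans (+-congˡ (coeff-· a f u)) (sym (distribˡ a b _))
  ... | no  _ = coeff-· a f u

  coeff-∷-≢ : ∀ a {y u} f → y ≢ u → coeff ((a , y) ∷ f) u ≡ coeff f u
  coeff-∷-≢ a {y} {u} f y≢u with y ≟W u
  ... | yes y≡u = ⊥-elim (y≢u y≡u)
  ... | no  _   = ≡.refl

  coeff-∷-congʳ : ∀ a y {f g u} → coeff f u ≈ coeff g u → coeff ((a , y) ∷ f) u ≈ coeff ((a , y) ∷ g) u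
  coeff-∷-congʳ a y {u = u} e with y ≟W u
  ... | yes _ = +-congˡ e
  ... | no  _ = e

  coeff-concat : ∀ {a} {A : Set a} (h : A → Vect) l u → coeff (concat (map h l)) u ≈ ∑ l (λ p → coeff (h p) u)
  coeff-concat h []      u = refl
  coeff-concat h (p ∷ l) u = trans (coeff-++ (h p) _ u) (+-congˡ (coeff-concat h l u))

  coeff-sumE : ∀ {a} {A : Set a} (ψ : A → End) l x u →
               coeff (sumE (map ψ l) x) u ≈ ∑ l (λ p → coeff (ψ p x) u)
  coeff-sumE ψ []      x u = refl
  coeff-sumE ψ (p ∷ l) x u = trans (coeff-++ (ψ p x) _ u) (+-congˡ (coeff-sumE ψ l x u))

  multiplicity : List Word → Word → Carrier
  multiplicity l u = coeff (map (1# ,_) l) u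

  coeff-map-const : ∀ a l u → coeff (map (a ,_) l) u ≈ a *ₖ multiplicity l u
  coeff-map-const a []      u = sym (zeroʳ a)
  coeff-map-const a (z ∷ l) u with z ≟W u
  ... | yes _ = trans (+-cong (sym (*-identityʳ a)) (coeff-map-const a l u)) (sym (distribˡ a 1# _))
  ... | no  _ = coeff-map-const a l u

  pair : Vect → (Word → Carrier) → Carrier
  pair f Φ = ∑ f (λ { (a , x) → a *ₖ Φ x })

  pair-++ : ∀ f g Φ → pair (f ++ g) Φ ≈ pair f Φ +ₖ pair g Φ
  pair-++ f g Φ = ∑-++ f g _

  pair-· : ∀ a f Φ → pair (a ·V f) Φ ≈ a *ₖ pair f Φ
  pair-· a f Φ = trans (∑-map _ f _) (trans (∑-cong f (λ { (b , x) → *-assoc a b (Φ x) })) (∑-*ˡ f a _))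

  pair-congʳ : ∀ f {Φ Ψ} → (∀ x → Φ x ≈ Ψ x) → pair f Φ ≈ pair f Ψ
  pair-congʳ f e = ∑-cong f (λ { (a , x) → *-congˡ (e x) })

  pair-+ʳ : ∀ f Φ Ψ → pair f (λ x → Φ x +ₖ Ψ x) ≈ pair f Φ +ₖ pair f Ψ
  pair-+ʳ f Φ Ψ = trans (∑-cong f (λ { (a , x) → distribˡ a (Φ x) (Ψ x) })) (∑-+ f _ _)

  pair-*ʳ : ∀ f b Φ → pair f (λ x → b *ₖ Φ x) ≈ b *ₖ pair f Φ
  pair-*ʳ f b Φ = trans (∑-cong f (λ { (a , x) → *-exchange a b (Φ x) })) (∑-*ˡ f b _)

  pair-zeroʳ : ∀ f → pair f (λ _ → 0#) ≈ 0#
  pair-zeroʳ f = ∑-zero (All.universal (λ { (a , x) → zeroʳ a }) f)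

  erase : Word → Vect → Vect
  erase x []            = []
  erase x ((a , y) ∷ f) with y ≟W x
  ... | yes _ = erase x f
  ... | no  _ = (a , y) ∷ erase x f

  pair-erase : ∀ f x Φ → pair f Φ ≈ coeff f x *ₖ Φ x +ₖ pair (erase x f) Φ
  pair-erase []            x Φ = sym (trans (+-identityʳ _) (zeroˡ (Φ x)))
  pair-erase ((a , y) ∷ f) x Φ with y ≟W x
  ... | yes ≡.refl = trans (+-congˡ (pair-erase f y Φ))
                           (trans (sym (+-assoc _ _ _)) (+-congʳ (sym (distribʳ (Φ y) a _))))
  ... | no  _      = trans (+-congˡ (pair-erase f x Φ)) (+-exchange _ _ _)

  coeff-erase-self : ∀ f x → coeff (erase x f) x ≈ 0#
  coeff-erase-self []            x = refl
  coeff-erase-self ((a , y) ∷ f) x with y ≟W x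
  ... | yes _   = coeff-erase-self f x
  ... | no  y≢x = trans (reflexive (coeff-∷-≢ a (erase x f) y≢x)) (coeff-erase-self f x)

  coeff-erase-other : ∀ f {x u} → x ≢ u → coeff (erase x f) u ≈ coeff f u
  coeff-erase-other []            x≢u = refl
  coeff-erase-other ((a , y) ∷ f) {x} x≢u with y ≟W x
  ... | yes ≡.refl = trans (coeff-erase-other f x≢u) (sym (reflexive (coeff-∷-≢ a f x≢u)))
  ... | no  _      = coeff-∷-congʳ a y (coeff-erase-other f x≢u)

  erase-cong : ∀ x f g → f ≈V g → erase x f ≈V erase x g
  erase-cong x f g f≈g u with x ≟W u
  ... | yes ≡.refl = trans (coeff-erase-self f x) (sym (coeff-erase-self g x))
  ... | no  x≢u    = trans (coeff-erase-other f x≢u) (trans (f≈g u) (sym (coeff-erase-other g x≢u)))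

  length-erase : ∀ x f → length (erase x f) ≤ length f
  length-erase x []            = z≤n
  length-erase x ((a , y) ∷ f) with y ≟W x
  ... | yes _ = ≤-trans (length-erase x f) (n≤1+n _)
  ... | no  _ = s≤s (length-erase x f)

  length-erase-∷ : ∀ x a f → length (erase x ((a , x) ∷ f)) ≤ length f
  length-erase-∷ x a f with x ≟W x
  ... | yes _   = length-erase x f
  ... | no  x≢x = ⊥-elim (x≢x ≡.refl)

  pair-cong-erase : ∀ x f g Φ → f ≈V g → pair (erase x f) Φ ≈ pair (erase x g) Φ → pair f Φ ≈ pair g Φ
  pair-cong-erase x f g Φ f≈g rest =
    trans (pair-erase f x Φ) (trans (+-cong (*-congʳ (f≈g x)) rest) (sym (pair-erase g x Φ)))

  -- A Vect may repeat a word, so f ≈V g gives no termwise comparison: erase one word from both sides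
  -- and recurse on the total length.
  pair-cong-bounded : ∀ n f g Φ → length f + length g ≤ n → f ≈V g → pair f Φ ≈ pair g Φ
  pair-cong-bounded _       []                 []                 Φ _        _   = refl
  pair-cong-bounded (suc n) f@((a , x) ∷ f′) g                  Φ (s≤s le) f≈g =
    pair-cong-erase x f g Φ f≈g
      (pair-cong-bounded n (erase x f) (erase x g) Φ
                         (≤-trans (+-mono-≤ (length-erase-∷ x a f′) (length-erase x g)) le) (erase-cong x f g f≈g))
  pair-cong-bounded (suc n) []                 g@((b , y) ∷ g′) Φ (s≤s le) f≈g =
    pair-cong-erase y [] g Φ f≈g
      (pair-cong-bounded n [] (erase y g) Φ (≤-trans (length-erase-∷ y b g′) le) (erase-cong y [] g f≈g))

  pair-cong : ∀ f g Φ → f ≈V g → pair f Φ ≈ pair g Φ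
  pair-cong f g Φ = pair-cong-bounded _ f g Φ ≤-refl

  shPair : Vect → Vect → Word → Carrier
  shPair f g u = pair f (λ p → pair g (λ q → multiplicity (shW p q) u))

  coeff-sh : ∀ f g u → coeff (sh f g) u ≈ shPair f g u
  coeff-sh f g u = trans (coeff-concat _ f u) (∑-cong f λ { (a , x) →
    trans (coeff-concat _ g u)
          (trans (∑-cong g (λ { (b , y) → trans (coeff-map-const (a *ₖ b) (shW x y) u) (*-assoc a b _) }))
                 (∑-*ˡ g a _)) })

  shPair-cong : ∀ f f′ g g′ u → f ≈V f′ → g ≈V g′ → shPair f g u ≈ shPair f′ g′ u
  shPair-cong f f′ g g′ u f≈f′ g≈g′ =
    trans (pair-cong f f′ _ f≈f′) (pair-congʳ f′ (λ p → pair-cong g g′ _ g≈g′))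

  shPair-++ˡ : ∀ f f′ g u → shPair (f ++ f′) g u ≈ shPair f g u +ₖ shPair f′ g u
  shPair-++ˡ f f′ g u = pair-++ f f′ _

  shPair-++ʳ : ∀ f g g′ u → shPair f (g ++ g′) u ≈ shPair f g u +ₖ shPair f g′ u
  shPair-++ʳ f g g′ u = trans (pair-congʳ f (λ p → pair-++ g g′ _)) (pair-+ʳ f _ _)

  shPair-zeroʳ : ∀ f u → shPair f zeroV u ≈ 0#
  shPair-zeroʳ f u = pair-zeroʳ f

  shPair-· : ∀ a f b g u → shPair (a ·V f) (b ·V g) u ≈ (a *ₖ b) *ₖ shPair f g u
  shPair-· a f b g u =
    trans (pair-· a f _)
          (trans (*-congˡ (trans (pair-congʳ f (λ p → pair-· b g _)) (pair-*ʳ f b _))) (sym (*-assoc a b _)))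

  shPair-basis : ∀ p q u → shPair (basis p) (basis q) u ≈ multiplicity (shW p q) u
  shPair-basis p q u = trans (+-identityʳ _) (trans (*-identityˡ _) (trans (+-identityʳ _) (*-identityˡ _)))

  cuts : Word → List ℕ
  cuts x = upTo (suc (length x))

  convCoeff : End → End → Word → Word → Carrier
  convCoeff F G x u = ∑ (cuts x) (λ i → shPair (F (take i x)) (G (drop i x)) u)

  coeff-⋆ : ∀ F G x u → coeff ((F ⋆ G) x) u ≈ convCoeff F G x u
  coeff-⋆ F G x u =
    trans (coeff-concat (λ { (y , z) → sh (F y) (G z) }) (splits x) u)
          (trans (∑-map _ (cuts x) _)
                 (∑-cong (cuts x) (λ i → coeff-sh (F (take i x)) (G (drop i x)) u)))

  convCoeff-cong : ∀ F F′ G G′ → F ≈E F′ → G ≈E G′ → ∀ x → IsWord x → ∀ u →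
                   convCoeff F G x u ≈ convCoeff F′ G′ x u
  convCoeff-cong F F′ G G′ F≈F′ G≈G′ x x-word u =
    ∑-cong (cuts x)
           (λ i → shPair-cong (F (take i x)) (F′ (take i x)) (G (drop i x)) (G′ (drop i x)) u
                              (F≈F′ (take i x) (take⁺ i x-word)) (G≈G′ (drop i x) (drop⁺ i x-word)))

  convCoeff-· : ∀ a F b G x u → convCoeff (a ·E F) (b ·E G) x u ≈ (a *ₖ b) *ₖ convCoeff F G x u
  convCoeff-· a F b G x u =
    trans (∑-cong (cuts x) (λ i → shPair-· a (F (take i x)) b (G (drop i x)) u))
          (∑-*ˡ (cuts x) (a *ₖ b) _)

  convCoeff-sumEˡ : ∀ {a} {A : Set a} (ψ : A → End) l G x u →
                    convCoeff (sumE (map ψ l)) G x u ≈ ∑ l (λ p → convCoeff (ψ p) G x u)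
  convCoeff-sumEˡ ψ []      G x u = ∑-zero (All.universal (λ _ → refl) (cuts x))
  convCoeff-sumEˡ ψ (p ∷ l) G x u =
    trans (∑-cong (cuts x) (λ i → shPair-++ˡ (ψ p (take i x)) _ (G (drop i x)) u))
          (trans (∑-+ (cuts x) _ _) (+-congˡ (convCoeff-sumEˡ ψ l G x u)))

  convCoeff-sumEʳ : ∀ {a} {A : Set a} (ψ : A → End) l F x u →
                    convCoeff F (sumE (map ψ l)) x u ≈ ∑ l (λ p → convCoeff F (ψ p) x u)
  convCoeff-sumEʳ ψ []      F x u = ∑-zero (All.universal (λ i → shPair-zeroʳ (F (take i x)) u) (cuts x))
  convCoeff-sumEʳ ψ (p ∷ l) F x u =
    trans (∑-cong (cuts x) (λ i → shPair-++ʳ (F (take i x)) (ψ p (drop i x)) _ u))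
          (trans (∑-+ (cuts x) _ _) (+-congˡ (convCoeff-sumEʳ ψ l F x u)))

  letter-take : ∀ x {j c} → c ≤ j → letter x c ≡ letter (take j x) c
  letter-take []      {zero}  _ = ≡.refl
  letter-take []      {suc j} _ = ≡.refl
  letter-take (a ∷ x) {zero}  {zero} _ = ≡.refl
  letter-take (a ∷ x) {suc j} {zero} _ = ≡.refl
  letter-take (a ∷ x) {suc j} {suc zero} _ = ≡.refl
  letter-take (a ∷ x) {suc j} {suc (suc c)} (s≤s c<j) = letter-take x c<j

  -- letter is 1-indexed, with the junk value letter x 0 = 0; hence 1 ≤ c.
  letter-drop : ∀ x m {c} → 1 ≤ c → letter x (c + m) ≡ letter (drop m x) c
  letter-drop x       zero    {suc b} _ = cong (letter x) (ℕ.+-identityʳ (suc b))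
  letter-drop []      (suc m) {suc b} _ = ≡.refl
  letter-drop (a ∷ x) (suc m) {suc b} _ =
    ≡.trans (cong (letter (a ∷ x)) (ℕ.+-suc (suc b) m)) (letter-drop x m (s≤s z≤n))

  letter-shW : ∀ x m v w → All (_≤ m) v → IsWord w →
               map (map (letter x)) (shW v (w ↑ m)) ≡ shW (map (letter (take m x)) v) (map (letter (drop m x)) w)
  letter-shW x m v w v≤m w-word =
    ≡.trans (map-shW (letter x) v (w ↑ m))
            (cong₂ shW (map-cong-local (All.map (letter-take x) v≤m))
                       (≡.trans (≡.sym (map-∘ w)) (map-cong-local (All.map (letter-drop x m) w-word))))

  bracket-length≡ : ∀ w {n} y → length y ≡ n → bracket w n y ≡ basis (map (letter y) w)
  bracket-length≡ w {n} y y≡n with length y ≟ n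
  ... | yes _   = ≡.refl
  ... | no  y≢n = ⊥-elim (y≢n y≡n)

  bracket-length≢ : ∀ w {n} y → length y ≢ n → bracket w n y ≡ zeroV
  bracket-length≢ w {n} y y≢n with length y ≟ n
  ... | yes y≡n = ⊥-elim (y≢n y≡n)
  ... | no  _   = ≡.refl

  sumE-bracket-length≡ : ∀ {K} x l → length x ≡ K →
                         sumE (map (λ s → bracket s K) l) x ≡ map (λ s → (1# , map (letter x) s)) l
  sumE-bracket-length≡ x []      x≡K = ≡.refl
  sumE-bracket-length≡ x (s ∷ l) x≡K = cong₂ _++_ (bracket-length≡ s x x≡K) (sumE-bracket-length≡ x l x≡K)

  sumE-bracket-length≢ : ∀ {K} x l → length x ≢ K → sumE (map (λ s → bracket s K) l) x ≡ zeroV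
  sumE-bracket-length≢ x []      x≢K = ≡.refl
  sumE-bracket-length≢ x (s ∷ l) x≢K = cong₂ _++_ (bracket-length≢ s x x≢K) (sumE-bracket-length≢ x l x≢K)

  coeff-sumE-bracket : ∀ {K} x l u → length x ≡ K →
                       coeff (sumE (map (λ s → bracket s K) l) x) u ≡ multiplicity (map (map (letter x)) l) u
  coeff-sumE-bracket x l u x≡K = cong (λ f → coeff f u) (≡.trans (sumE-bracket-length≡ x l x≡K) (map-∘ l))

  shPair-bracket-vanishes : ∀ v m y w n z u → ¬ (length y ≡ m × length z ≡ n) →
                            shPair (bracket v m y) (bracket w n z) u ≈ 0#
  shPair-bracket-vanishes v m y w n z u ¬both with length y ≟ m
  ... | no  _   = refl
  ... | yes y≡m = trans (reflexive (cong (λ g → shPair (basis (map (letter y) v)) g u)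
                                         (bracket-length≢ w z (λ z≡n → ¬both (y≡m , z≡n)))))
                        (shPair-zeroʳ (basis (map (letter y) v)) u)

  convCoeff-bracket : ∀ v w m n → IsWord w → maxW v ≤ m → ∀ x u →
                      convCoeff (bracket v m) (bracket w n) x u
                        ≈ coeff (sumE (map (λ s → bracket s (m + n)) (shW v (w ↑ m))) x) u
  convCoeff-bracket v w m n w-word v≤m x u with length x ≟ m + n
  ... | no x≢m+n = begin
    convCoeff (bracket v m) (bracket w n) x u
      ≈⟨ ∑-zero (All.universal every-term-vanishes (cuts x)) ⟩
    0#
      ≡⟨ cong (λ f → coeff f u) (sumE-bracket-length≢ x (shW v (w ↑ m)) x≢m+n) ⟨
    coeff (sumE (map (λ s → bracket s (m + n)) (shW v (w ↑ m))) x) u ∎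
    where
    every-term-vanishes : ∀ i → shPair (bracket v m (take i x)) (bracket w n (drop i x)) u ≈ 0#
    every-term-vanishes i = shPair-bracket-vanishes v m (take i x) w n (drop i x) u λ (take≡m , drop≡n) →
      x≢m+n (≡.trans (≡.sym (length-take+length-drop i x)) (cong₂ _+_ take≡m drop≡n))
  ... | yes x≡m+n = begin
    convCoeff (bracket v m) (bracket w n) x u
      ≈⟨ ∑-applyUpTo-single id (suc (length x)) (s≤s m≤x) other-terms-vanish ⟩
    shPair (bracket v m (take m x)) (bracket w n (drop m x)) u
      ≡⟨ cong₂ (λ f g → shPair f g u) (bracket-length≡ v (take m x) (length-take-≤ x m≤x))
                                      (bracket-length≡ w (drop m x) drop≡n) ⟩
    shPair (basis (map (letter (take m x)) v)) (basis (map (letter (drop m x)) w)) u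
      ≈⟨ shPair-basis (map (letter (take m x)) v) (map (letter (drop m x)) w) u ⟩
    multiplicity (shW (map (letter (take m x)) v) (map (letter (drop m x)) w)) u
      ≡⟨ cong (λ l → multiplicity l u) (letter-shW x m v w (maxW≤⇒All≤ v v≤m) w-word) ⟨
    multiplicity (map (map (letter x)) (shW v (w ↑ m))) u
      ≡⟨ coeff-sumE-bracket x (shW v (w ↑ m)) u x≡m+n ⟨
    coeff (sumE (map (λ s → bracket s (m + n)) (shW v (w ↑ m))) x) u ∎
    where
    other-terms-vanish : ∀ {i} → i < suc (length x) → i ≢ m →
                         shPair (bracket v m (take i x)) (bracket w n (drop i x)) u ≈ 0#
    other-terms-vanish {i} i≤x i≢m = shPair-bracket-vanishes v m (take i x) w n (drop i x) u λ (take≡m , _) →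
      i≢m (≡.trans (≡.sym (length-take-≤ x (≤-pred i≤x))) take≡m)
    m≤x : m ≤ length x
    m≤x = ≤-trans (m≤m+n m n) (≤-reflexive (≡.sym x≡m+n))
    drop≡n : length (drop m x) ≡ n
    drop≡n = ≡.trans (length-drop m x) (≡.trans (cong (_∸ m) x≡m+n) (m+n∸m≡n m n))

  bracket⋆bracket : ∀ v w m n → IsWord w → maxW v ≤ m →
                    (bracket v m ⋆ bracket w n) ≈E sumE (map (λ s → bracket s (m + n)) (shW v (w ↑ m)))
  bracket⋆bracket v w m n w-word v≤m x _ u =
    trans (coeff-⋆ (bracket v m) (bracket w n) x u) (convCoeff-bracket v w m n w-word v≤m x u)

  Admissible : Carrier × Word × ℕ → Set
  Admissible (_ , w , n) = IsWord w × maxW w ≤ n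

  scaledBracket : Carrier × Word × ℕ → End
  scaledBracket (a , w , n) = a ·E bracket w n

  span : List (Carrier × Word × ℕ) → End
  span L = sumE (map scaledBracket L)

  productTerms : Carrier × Word × ℕ → Carrier × Word × ℕ → List (Carrier × Word × ℕ)
  productTerms (a , v , m) (b , w , n) = map (λ s → (a *ₖ b , s , m + n)) (shW v (w ↑ m))

  productTerms-admissible : ∀ {p q} → Admissible p → Admissible q → All Admissible (productTerms p q)
  productTerms-admissible (v-word , v≤m) (w-word , w≤n) = map⁺ (shW-admissible v-word w-word v≤m w≤n)

  coeff-span-concatMap : ∀ {a} {A : Set a} (h : A → List (Carrier × Word × ℕ)) l x u →
                         coeff (span (concatMap h l) x) u ≈ ∑ l (λ p → coeff (span (h p) x) u)
  coeff-span-concatMap h l x u =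
    trans (coeff-sumE scaledBracket (concatMap h l) x u)
          (trans (∑-concatMap h l _) (∑-cong l (λ p → sym (coeff-sumE scaledBracket (h p) x u))))

  coeff-span-productTerms : ∀ a v m b w n x u →
    coeff (span (productTerms (a , v , m) (b , w , n)) x) u
      ≈ (a *ₖ b) *ₖ coeff (sumE (map (λ s → bracket s (m + n)) (shW v (w ↑ m))) x) u
  coeff-span-productTerms a v m b w n x u =
    trans (coeff-sumE scaledBracket (productTerms (a , v , m) (b , w , n)) x u)
      (trans (∑-map _ S _)
        (trans (∑-cong S (λ s → coeff-· (a *ₖ b) (bracket s (m + n) x) u))
          (trans (∑-*ˡ S (a *ₖ b) _) (*-congˡ (sym (coeff-sumE (λ s → bracket s (m + n)) S x u))))))
    where
    S = shW v (w ↑ m)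

  convCoeff-scaledBracket : ∀ {p q} → Admissible p → Admissible q → ∀ x u →
    convCoeff (scaledBracket p) (scaledBracket q) x u ≈ coeff (span (productTerms p q) x) u
  convCoeff-scaledBracket {a , v , m} {b , w , n} (_ , v≤m) (w-word , _) x u =
    trans (convCoeff-· a (bracket v m) b (bracket w n) x u)
          (trans (*-congˡ (convCoeff-bracket v w m n w-word v≤m x u))
                 (sym (coeff-span-productTerms a v m b w n x u)))

  unitE∈W : InW unitE
  unitE∈W = (1# , [] , 0) ∷ [] , ([] , z≤n) ∷ [] , λ where
    []      _ u → sym (trans (coeff-++ (1# ·V basis []) [] u)
                             (trans (+-identityʳ _) (trans (coeff-· 1# (basis []) u) (*-identityˡ _))))
    (_ ∷ _) _ u → refl

  ⋆-closed : ∀ F G → InW F → InW G → InW (F ⋆ G)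
  ⋆-closed F G (LF , LF-admissible , F≈) (LG , LG-admissible , G≈) =
    products , admissible , λ x x-word u → begin
      coeff ((F ⋆ G) x) u                     ≈⟨ coeff-⋆ F G x u ⟩
      convCoeff F G x u                       ≈⟨ convCoeff-cong F (span LF) G (span LG) F≈ G≈ x x-word u ⟩
      convCoeff (span LF) (span LG) x u
        ≈⟨ trans (convCoeff-sumEˡ scaledBracket LF (span LG) x u)
                 (∑-cong LF (λ p → convCoeff-sumEʳ scaledBracket LG (scaledBracket p) x u)) ⟩
      ∑ LF (λ p → ∑ LG (λ q → convCoeff (scaledBracket p) (scaledBracket q) x u))
        ≈⟨ ∑-cong-All (All.map (λ p-adm → ∑-cong-All (All.map (λ q-adm →
             convCoeff-scaledBracket p-adm q-adm x u) LG-admissible)) LF-admissible) ⟩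
      ∑ LF (λ p → ∑ LG (λ q → coeff (span (productTerms p q) x) u))
        ≈⟨ trans (coeff-span-concatMap _ LF x u)
                 (∑-cong LF (λ p → coeff-span-concatMap (productTerms p) LG x u)) ⟨
      coeff (span products x) u ∎
    where
    products : List (Carrier × Word × ℕ)
    products = concatMap (λ p → concatMap (productTerms p) LG) LF
    admissible : All Admissible products
    admissible = concat⁺ (map⁺ (All.map (λ p-adm →
                   concat⁺ (map⁺ (All.map (productTerms-admissible p-adm) LG-admissible))) LF-admissible))

proposition3p3 : ∀ {c ℓ} (k : Field c ℓ) → let open Shuffle k in
    (∀ (v w : Word) (m n : ℕ) → IsWord v → IsWord w → maxW v ≤ m → maxW w ≤ n →
      (bracket v m ⋆ bracket w n) ≈E sumE (map (λ u → bracket u (m + n)) (shW v (w ↑ m))))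
    × (InW unitE × (∀ F G → InW F → InW G → InW (F ⋆ G)))
-- IsWord v and maxW w ≤ n are not needed: a letter of w beyond n reads the junk value 0 on both sides.
proposition3p3 k =
  (λ v w m n _ w-word v≤m _ → bracket⋆bracket k v w m n w-word v≤m) , unitE∈W k , ⋆-closed k
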